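{- Let $S$ be a reflectively closed set of block decompositions of fixed weight and fixed number of blocks, let $T$ be the set of all odd-length subsequences on the words of the block decompositions in $S$, and let $P \in T$ with $\rho P \neq P$ (so that $\{P, \rho P\}$ is an orbit of size $2$ of $\{\mathrm{id}, \rho\}$ on $T$). Then either $P$ and $\rho P$ are both trivial, or both are non-trivial.
   Context: For $\epsilon \in \{0,1\}$, $W_\epsilon^\ell$ is the alternating word of length $\ell$ starting with $\epsilon$. A block decomposition $B = (\epsilon_1; \ell_1, \ldots, \ell_n)$ has word $W_{\epsilon_1}^{\ell_1}\cdots W_{\epsilon_n}^{\ell_n}$, $\epsilon_{i+1} \equiv \epsilon_i + \ell_i - 1 \pmod 2$, and weight $\sum \ell_i - 2$. The reflection $\rho_{j,k}$ reverses $\ell_j, \ldots, \ell_k$ keeping $\epsilon_1$ and other lengths; a set of block decompositions of fixed weight and block number $n$ is reflectively closed if stable under all $\rho_{j,k}$, $1 \le j \le k \le n$. A subsequence of $\mathrm{word}(B)$ is a contiguous substring of length at least 2, encoded as $P = (B; s, t; \alpha, \beta)$ (starts in block $s$ after $\alpha$ of its letters, ends in block $t$ with $\beta$ of its letters after it). $\rho P := (\rho_{s,t}B; s,t; \beta,\alpha)$. $P$ is trivial if its first and last letters coincide. -}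

module Defs where

open import Data.Bool using (Bool; true; false; not)
open import Data.Nat using (ℕ; zero; suc; _+_; _∸_; _≤_; _<_)
open import Data.List using (List; []; _∷_; _++_; take; drop; reverse; length; head; last)
open import Data.Nat.ListAction using (sum)
open import Data.List.Relation.Unary.All using (All)
open import Data.Maybe using (Maybe)
open import Data.Product using (_×_)
open import Relation.Binary.PropositionalEquality using (_≡_; _≢_)
open import Relation.Nullary using (¬_)

flipN : ℕ → Bool → Bool
flipN zero    b = b
flipN (suc n) b = not (flipN n b)

W : Bool → ℕ → List Bool
W ε zero    = []
W ε (suc ℓ) = ε ∷ W (not ε) ℓ

-- ε_{i+1} ≡ ε_i + ℓ_i - 1 (mod 2)
nextEps : Bool → ℕ → Bool
nextEps ε zero    = not ε
nextEps ε (suc ℓ) = flipN ℓ ε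

wordFrom : Bool → List ℕ → List Bool
wordFrom ε []       = []
wordFrom ε (ℓ ∷ ls) = W ε ℓ ++ wordFrom (nextEps ε ℓ) ls

record BlockDecomp : Set where
  constructor bd
  field
    eps  : Bool
    lens : List ℕ
open BlockDecomp public

IsBlockDecomp : BlockDecomp → Set
IsBlockDecomp B = All (λ ℓ → 1 ≤ ℓ) (lens B)

word : BlockDecomp → List Bool
word B = wordFrom (eps B) (lens B)

numBlocks : BlockDecomp → ℕ
numBlocks B = length (lens B)

weight : BlockDecomp → ℕ
weight B = sum (lens B) ∸ 2

-- reversal of the entries j..k (1-indexed, inclusive) of a list
revRange : ℕ → ℕ → List ℕ → List ℕ
revRange j k ls =
  take (j ∸ 1) ls ++ reverse (take (suc k ∸ j) (drop (j ∸ 1) ls)) ++ drop k ls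

ρ : ℕ → ℕ → BlockDecomp → BlockDecomp
ρ j k B = bd (eps B) (revRange j k (lens B))

BDSet : Set₁
BDSet = BlockDecomp → Set

ReflectivelyClosed : ℕ → ℕ → BDSet → Set
ReflectivelyClosed n w S =
  (∀ B → S B → IsBlockDecomp B × numBlocks B ≡ n × weight B ≡ w) ×
  (∀ j k B → 1 ≤ j → j ≤ k → k ≤ n → S B → S (ρ j k B))

-- subsequence P = (B; s, t; α, β), blocks 1-indexed
record Subseq : Set where
  constructor subseq
  field
    base  : BlockDecomp
    s t   : ℕ
    α β   : ℕ
open Subseq public

-- ℓ_i (1-indexed), 0 if out of range
blockLen : BlockDecomp → ℕ → ℕ
blockLen B i = sum (take 1 (drop (i ∸ 1) (lens B)))

-- 0-indexed position in word(B) of the first letter of P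
startPos : Subseq → ℕ
startPos P = sum (take (s P ∸ 1) (lens (base P))) + α P

subLen : Subseq → ℕ
subLen P = sum (take (t P) (lens (base P))) ∸ β P ∸ startPos P

-- P is a (well-formed) subsequence of word(B): starts in block s after α
-- of its letters, ends in block t with β letters of it after, length ≥ 2
IsSubseq : Subseq → Set
IsSubseq P =
  1 ≤ s P × s P ≤ t P × t P ≤ numBlocks (base P) ×
  α P < blockLen (base P) (s P) × β P < blockLen (base P) (t P) ×
  2 ≤ subLen P

subword : Subseq → List Bool
subword P = take (subLen P) (drop (startPos P) (word (base P)))

ρS : Subseq → Subseq
ρS P = subseq (ρ (s P) (t P) (base P)) (s P) (t P) (β P) (α P)

data Odd : ℕ → Set where
  one  : Odd 1
  s+2  : ∀ {n} → Odd n → Odd (suc (suc n))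

InT : BDSet → Subseq → Set
InT S P = S (base P) × IsSubseq P × Odd (length (subword P))

Trivial : Subseq → Set
Trivial P = head (subword P) ≡ last (subword P)

module Submission where

-- In word(B) consecutive letters alternate inside a block,
-- while at a block boundary the letter repeats (ε_{i+1} ≡ ε_i + ℓ_i − 1).
-- Hence the letter at position p lying in block i (0-indexed) is ε₁
-- flipped p + i times, and for a subsequence P = (B; s, t; α, β) of
-- length L the last letter is the first letter flipped (L − 1) + (t − s)
-- times.  Triviality of P therefore depends only on the parity of
-- (L − 1) + (t − s).  The reflection ρ_{s,t} keeps the prefix sums
-- ℓ₁ + … + ℓ_{s−1} and ℓ₁ + … + ℓ_t and swaps ℓ_s with ℓ_t, so ρP is again
-- a well-formed subsequence with the same s, t and the same length; so P
-- and ρP are trivial or non-trivial together.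

open import Defs
open import Data.Bool using (Bool; not)
open import Data.Bool.Properties using (not-involutive; not-¬)
open import Data.Nat using (ℕ; zero; suc; _+_; _∸_; _≤_; _<_; z≤n; s≤s; s≤s⁻¹)
open import Data.Nat.Properties
open import Data.Nat.ListAction using (sum)
open import Data.Nat.ListAction.Properties using (sum-++; sum-↭)
open import Data.Nat.Solver using (module +-*-Solver)
open import Data.List using (List; []; _∷_; _++_; take; drop; reverse; length; head; last)
open import Data.List.Properties
  using (length-++; ++-assoc; reverse-++; reverse-involutive; length-reverse;
         take++drop≡id; drop-drop; length-take; length-drop)
open import Data.List.Reverse using (reverseView; []; _∶_∶ʳ_)
open import Data.List.Relation.Binary.Permutation.Propositional.Properties using (↭-reverse)
open import Data.Maybe using (Maybe; just; nothing)
open import Data.Maybe.Properties using (just-injective)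
open import Data.Product using (Σ; _×_; _,_; proj₁; proj₂)
open import Data.Sum using (_⊎_; inj₁; inj₂)
open import Relation.Binary.PropositionalEquality
open import Relation.Nullary using (¬_)

open +-*-Solver using (solve; _:=_; _:+_; con)

flipN-not : ∀ n b → flipN n (not b) ≡ not (flipN n b)
flipN-not zero    b = refl
flipN-not (suc n) b = cong not (flipN-not n b)

flipN-+ : ∀ m n b → flipN (m + n) b ≡ flipN m (flipN n b)
flipN-+ zero    n b = refl
flipN-+ (suc m) n b = cong not (flipN-+ m n b)

-- The next block starts with the last letter of the current one, that is
-- with its first letter flipped ℓ − 1 ≡ ℓ + 1 (mod 2) times.
nextEps-flipN : ∀ b ℓ → nextEps b ℓ ≡ flipN (suc ℓ) b
nextEps-flipN b zero    = refl
nextEps-flipN b (suc ℓ) = sym (not-involutive (flipN ℓ b))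

flipN-dichotomy : ∀ k → (∀ b → flipN k b ≡ b) ⊎ (∀ b → flipN k b ≡ not b)
flipN-dichotomy zero = inj₁ (λ b → refl)
flipN-dichotomy (suc k) with flipN-dichotomy k
... | inj₁ even = inj₂ (λ b → cong not (even b))
... | inj₂ odd  = inj₁ (λ b → trans (cong not (odd b)) (not-involutive b))

letterAt : List Bool → ℕ → Maybe Bool
letterAt []       _       = nothing
letterAt (x ∷ xs) zero    = just x
letterAt (x ∷ xs) (suc p) = letterAt xs p

letterAt-++ˡ : ∀ xs ys p → p < length xs → letterAt (xs ++ ys) p ≡ letterAt xs p
letterAt-++ˡ (x ∷ xs) ys zero    _       = refl
letterAt-++ˡ (x ∷ xs) ys (suc p) (s≤s p<) = letterAt-++ˡ xs ys p p<

letterAt-++ʳ : ∀ xs ys p → letterAt (xs ++ ys) (length xs + p) ≡ letterAt ys p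
letterAt-++ʳ []       ys p = refl
letterAt-++ʳ (x ∷ xs) ys p = letterAt-++ʳ xs ys p

length-W : ∀ b ℓ → length (W b ℓ) ≡ ℓ
length-W b zero    = refl
length-W b (suc ℓ) = cong suc (length-W (not b) ℓ)

letterAt-W : ∀ b ℓ o → o < ℓ → letterAt (W b ℓ) o ≡ just (flipN o b)
letterAt-W b (suc ℓ) zero    _        = refl
letterAt-W b (suc ℓ) (suc o) (s≤s o<) =
  trans (letterAt-W (not b) ℓ o o<) (cong just (flipN-not o b))

length-wordFrom : ∀ b ls → length (wordFrom b ls) ≡ sum ls
length-wordFrom b []       = refl
length-wordFrom b (ℓ ∷ ls) =
  trans (length-++ (W b ℓ)) (cong₂ _+_ (length-W b ℓ) (length-wordFrom (nextEps b ℓ) ls))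

-- Block bookkeeping with 0-indexed blocks: prefixSum i ls = ℓ₀ + … + ℓ_{i−1}
-- is the position where block i starts, and lenAt ls i = ℓ_i (0 if absent).
prefixSum : ℕ → List ℕ → ℕ
prefixSum i ls = sum (take i ls)

lenAt : List ℕ → ℕ → ℕ
lenAt ls i = sum (take 1 (drop i ls))

prefixSum-≤ : ∀ i ls → prefixSum i ls ≤ sum ls
prefixSum-≤ zero    ls       = z≤n
prefixSum-≤ (suc i) []       = z≤n
prefixSum-≤ (suc i) (ℓ ∷ ls) = +-monoʳ-≤ ℓ (prefixSum-≤ i ls)

prefixSum-suc : ∀ i ls → prefixSum (suc i) ls ≡ prefixSum i ls + lenAt ls i
prefixSum-suc zero    []       = refl
prefixSum-suc zero    (ℓ ∷ ls) = refl
prefixSum-suc (suc i) []       = refl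
prefixSum-suc (suc i) (ℓ ∷ ls) =
  trans (cong (ℓ +_) (prefixSum-suc i ls)) (sym (+-assoc ℓ _ _))

-- The parity law: the letter of word(b; ls) at position p = prefixSum i ls + o,
-- inside block i, is b flipped p + i times (p + i ≡ p − i mod 2: one flip per
-- step, except at the i block boundaries crossed).
letterAt-wordFrom : ∀ b ls i o → o < lenAt ls i →
  letterAt (wordFrom b ls) (prefixSum i ls + o) ≡ just (flipN (prefixSum i ls + o + i) b)
letterAt-wordFrom b (ℓ ∷ ls) zero o o< = begin
    letterAt (W b ℓ ++ _) o   ≡⟨ letterAt-++ˡ (W b ℓ) _ o (subst (o <_) (sym (length-W b ℓ)) o<ℓ) ⟩
    letterAt (W b ℓ) o        ≡⟨ letterAt-W b ℓ o o<ℓ ⟩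
    just (flipN o b)          ≡⟨ cong (λ k → just (flipN k b)) (sym (+-identityʳ o)) ⟩
    just (flipN (o + 0) b)    ∎
  where
  open ≡-Reasoning
  o<ℓ : o < ℓ
  o<ℓ = subst (o <_) (+-identityʳ ℓ) o<
letterAt-wordFrom b (ℓ ∷ ls) (suc i) o o< = begin
    letterAt (W b ℓ ++ rest) (ℓ + X + o)
      ≡⟨ cong (letterAt (W b ℓ ++ rest)) (trans (+-assoc ℓ X o) (cong (_+ (X + o)) (sym (length-W b ℓ)))) ⟩
    letterAt (W b ℓ ++ rest) (length (W b ℓ) + (X + o))
      ≡⟨ letterAt-++ʳ (W b ℓ) rest (X + o) ⟩
    letterAt rest (X + o)
      ≡⟨ letterAt-wordFrom (nextEps b ℓ) ls i o o< ⟩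
    just (flipN (X + o + i) (nextEps b ℓ))
      ≡⟨ cong (λ e → just (flipN (X + o + i) e)) (nextEps-flipN b ℓ) ⟩
    just (flipN (X + o + i) (flipN (suc ℓ) b))
      ≡⟨ cong just (sym (flipN-+ (X + o + i) (suc ℓ) b)) ⟩
    just (flipN (X + o + i + suc ℓ) b)
      ≡⟨ cong (λ k → just (flipN k b)) (solve 4 (λ X o i ℓ → X :+ o :+ i :+ (con 1 :+ ℓ) := ℓ :+ X :+ o :+ (con 1 :+ i)) refl X o i ℓ) ⟩
    just (flipN (ℓ + X + o + suc i) b)
      ∎
  where
  open ≡-Reasoning
  X = prefixSum i ls
  rest = wordFrom (nextEps b ℓ) ls

slice-head : ∀ (w : List Bool) a L' → a < length w →
  head (take (suc L') (drop a w)) ≡ letterAt w a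
slice-head (x ∷ w) zero    L' _        = refl
slice-head (x ∷ w) (suc a) L' (s≤s a<) = slice-head w a L' a<

slice-last : ∀ (w : List Bool) a L' → a + suc L' ≤ length w →
  last (take (suc L') (drop a w)) ≡ letterAt w (a + L')
slice-last (x ∷ w)     (suc a) L'       (s≤s fits) = slice-last w a L' fits
slice-last (x ∷ w)     zero    zero     _          = refl
slice-last (x ∷ y ∷ w) zero    (suc L') (s≤s fits) = slice-last (y ∷ w) zero L' fits

FlipEnds : List Bool → ℕ → Set
FlipEnds u k = Σ Bool λ X → head u ≡ just X × last u ≡ just (flipN k X)

flipEnds-sameTriviality : ∀ {u v k} → FlipEnds u k → FlipEnds v k →
  (head u ≡ last u × head v ≡ last v) ⊎ (head u ≢ last u × head v ≢ last v)
flipEnds-sameTriviality {k = k} (X , hu , lu) (Y , hv , lv) with flipN-dichotomy k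
... | inj₁ even = inj₁ (coincide hu lu (even X) , coincide hv lv (even Y))
  where
  coincide : ∀ {u Z} → head u ≡ just Z → last u ≡ just (flipN k Z) → flipN k Z ≡ Z → head u ≡ last u
  coincide h l fZ = trans h (sym (trans l (cong just fZ)))
... | inj₂ odd = inj₂ (differ hu lu (odd X) , differ hv lv (odd Y))
  where
  differ : ∀ {u Z} → head u ≡ just Z → last u ≡ just (flipN k Z) → flipN k Z ≡ not Z → head u ≢ last u
  differ h l fZ eq = not-¬ refl (just-injective (trans (sym h) (trans eq (trans l (cong just fZ)))))

∸≡suc⇒+ : ∀ m n k → m ∸ n ≡ suc k → n + suc k ≡ m
∸≡suc⇒+ (suc m) zero    k eq = sym eq
∸≡suc⇒+ (suc m) (suc n) k eq = cong suc (∸≡suc⇒+ m n k eq)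

lastLetter-offset : ∀ a L' T ℓ β → β < ℓ → a + suc L' ≡ T + ℓ ∸ β → a + L' ≡ T + (ℓ ∸ suc β)
lastLetter-offset a L' T ℓ β β<ℓ ends = suc-injective (begin
    suc (a + L')       ≡⟨ sym (+-suc a L') ⟩
    a + suc L'         ≡⟨ ends ⟩
    T + ℓ ∸ β          ≡⟨ +-∸-assoc T (<⇒≤ β<ℓ) ⟩
    T + (ℓ ∸ β)        ≡⟨ cong (T +_) (+-∸-assoc 1 β<ℓ) ⟩
    T + suc (ℓ ∸ suc β) ≡⟨ +-suc T _ ⟩
    suc (T + (ℓ ∸ suc β)) ∎)
  where open ≡-Reasoning

subword-ends : ∀ b ls s' t' α β L' → s' ≤ t' → α < lenAt ls s' → β < lenAt ls t' →
  prefixSum (suc t') ls ∸ β ∸ (prefixSum s' ls + α) ≡ suc L' →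
  FlipEnds (take (suc L') (drop (prefixSum s' ls + α) (wordFrom b ls))) (L' + (t' ∸ s'))
subword-ends b ls s' t' α β L' s≤t α< β< len = flipN (a + s') b , first , final
  where
  open ≡-Reasoning
  w = wordFrom b ls
  a = prefixSum s' ls + α
  ℓ = lenAt ls t'
  d = t' ∸ s'
  fits : a + suc L' ≡ prefixSum (suc t') ls ∸ β
  fits = ∸≡suc⇒+ (prefixSum (suc t') ls ∸ β) a L' len
  fitsWord : a + suc L' ≤ length w
  fitsWord = ≤-trans (≤-reflexive fits) (≤-trans (m∸n≤m _ β)
               (≤-trans (prefixSum-≤ (suc t') ls) (≤-reflexive (sym (length-wordFrom b ls)))))
  lastPos : a + L' ≡ prefixSum t' ls + (ℓ ∸ suc β)
  lastPos = lastLetter-offset a L' _ ℓ β β< (trans fits (cong (_∸ β) (prefixSum-suc t' ls)))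
  offset< : ℓ ∸ suc β < ℓ
  offset< = ≤-trans (≤-reflexive (sym (+-∸-assoc 1 β<))) (m∸n≤m ℓ β)
  first : head (take (suc L') (drop a w)) ≡ just (flipN (a + s') b)
  first = trans (slice-head w a L' (≤-trans (≤-trans (s≤s (m≤m+n a L')) (≤-reflexive (sym (+-suc a L')))) fitsWord))
                (letterAt-wordFrom b ls s' α α<)
  flips : a + L' + t' ≡ L' + d + (a + s')
  flips = trans (cong (a + L' +_) (sym (m∸n+n≡m s≤t)))
                (solve 4 (λ a L d s → a :+ L :+ (d :+ s) := L :+ d :+ (a :+ s)) refl a L' d s')
  final : last (take (suc L') (drop a w)) ≡ just (flipN (L' + d) (flipN (a + s') b))
  final = begin
    last (take (suc L') (drop a w))             ≡⟨ slice-last w a L' fitsWord ⟩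
    letterAt w (a + L')                         ≡⟨ cong (letterAt w) lastPos ⟩
    letterAt w (prefixSum t' ls + (ℓ ∸ suc β))  ≡⟨ letterAt-wordFrom b ls t' (ℓ ∸ suc β) offset< ⟩
    just (flipN (prefixSum t' ls + (ℓ ∸ suc β) + t') b) ≡⟨ cong (λ k → just (flipN (k + t') b)) (sym lastPos) ⟩
    just (flipN (a + L' + t') b)                ≡⟨ cong (λ k → just (flipN k b)) flips ⟩
    just (flipN (L' + d + (a + s')) b)          ≡⟨ cong just (flipN-+ (L' + d) (a + s') b) ⟩
    just (flipN (L' + d) (flipN (a + s') b))    ∎

subword-flipEnds : ∀ P → IsSubseq P → FlipEnds (subword P) (subLen P ∸ 1 + (t P ∸ s P))
subword-flipEnds (subseq B zero t α β) (() , _)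
subword-flipEnds (subseq B (suc s') zero α β) (_ , () , _)
subword-flipEnds P@(subseq (bd b ls) (suc s') (suc t') α β) (_ , s≤t , _ , α< , β< , 2≤L) =
  subst (λ L → FlipEnds (take L (drop (startPos P) (wordFrom b ls))) (L ∸ 1 + (t' ∸ s'))) (sym len)
    (subword-ends b ls s' t' α β (subLen P ∸ 1) (s≤s⁻¹ s≤t) α< β< len)
  where
  len : subLen P ≡ suc (subLen P ∸ 1)
  len = sym (trans (+-comm 1 (subLen P ∸ 1)) (m∸n+n≡m (≤-trans (s≤s z≤n) 2≤L)))

take-++-length : ∀ (A Y : List ℕ) → take (length A) (A ++ Y) ≡ A
take-++-length []      Y = refl
take-++-length (x ∷ A) Y = cong (x ∷_) (take-++-length A Y)

take-++-length+ : ∀ (A Y : List ℕ) n → take (length A + n) (A ++ Y) ≡ A ++ take n Y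
take-++-length+ []      Y n = refl
take-++-length+ (x ∷ A) Y n = cong (x ∷_) (take-++-length+ A Y n)

drop-++-length : ∀ (A Y : List ℕ) → drop (length A) (A ++ Y) ≡ Y
drop-++-length []      Y = refl
drop-++-length (x ∷ A) Y = drop-++-length A Y

drop-++-length+ : ∀ (A Y : List ℕ) n → drop (length A + n) (A ++ Y) ≡ drop n Y
drop-++-length+ []      Y n = refl
drop-++-length+ (x ∷ A) Y n = drop-++-length+ A Y n

lenAt-reverse-first : ∀ (M C : List ℕ) d → length M ≡ suc d → lenAt (reverse M ++ C) 0 ≡ lenAt (M ++ C) d
lenAt-reverse-first M C d lM with reverseView M
lenAt-reverse-first .[] C d () | []
lenAt-reverse-first .(N ++ y ∷ []) C d lM | N ∶ _ ∶ʳ y = begin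
    lenAt (reverse (N ++ y ∷ []) ++ C) 0   ≡⟨ cong (λ z → lenAt (z ++ C) 0) (reverse-++ N (y ∷ [])) ⟩
    y + 0                                   ≡⟨ cong (λ z → sum (take 1 z)) (sym (drop-++-length N (y ∷ C))) ⟩
    lenAt (N ++ y ∷ C) (length N)           ≡⟨ cong₂ lenAt (sym (++-assoc N (y ∷ []) C)) lN ⟩
    lenAt ((N ++ y ∷ []) ++ C) d            ∎
  where
  open ≡-Reasoning
  lN : length N ≡ d
  lN = suc-injective (trans (trans (+-comm 1 (length N)) (sym (length-++ N))) lM)

lenAt-reverse-last : ∀ (M C : List ℕ) d → length M ≡ suc d → lenAt (reverse M ++ C) d ≡ lenAt (M ++ C) 0
lenAt-reverse-last M C d lM = begin
    lenAt (reverse M ++ C) d                   ≡⟨ sym (lenAt-reverse-first (reverse M) C d (trans (length-reverse M) lM)) ⟩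
    lenAt (reverse (reverse M) ++ C) 0         ≡⟨ cong (λ z → lenAt (z ++ C) 0) (reverse-involutive M) ⟩
    lenAt (M ++ C) 0                           ∎
  where open ≡-Reasoning

prefixSum-through : ∀ (A M C : List ℕ) k → length M ≡ k → prefixSum (length A + k) (A ++ M ++ C) ≡ sum A + sum M
prefixSum-through A M C k refl = begin
    sum (take (length A + length M) (A ++ M ++ C)) ≡⟨ cong sum (take-++-length+ A (M ++ C) (length M)) ⟩
    sum (A ++ take (length M) (M ++ C))            ≡⟨ cong (λ z → sum (A ++ z)) (take-++-length M C) ⟩
    sum (A ++ M)                                   ≡⟨ sum-++ A M ⟩
    sum A + sum M                                  ∎
  where open ≡-Reasoning

record SwapsEnds (ls ls' : List ℕ) (s' t' : ℕ) : Set where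
  field
    prefix-before : prefixSum s' ls' ≡ prefixSum s' ls
    prefix-after  : prefixSum (suc t') ls' ≡ prefixSum (suc t') ls
    first-block   : lenAt ls' s' ≡ lenAt ls t'
    last-block    : lenAt ls' t' ≡ lenAt ls s'
    same-length   : length ls' ≡ length ls

reverse-middle-swapsEnds : ∀ {ls ls' s' t'} (A M C : List ℕ) d →
  ls ≡ A ++ M ++ C → ls' ≡ A ++ reverse M ++ C → length A ≡ s' → t' ≡ s' + d → length M ≡ suc d →
  SwapsEnds ls ls' s' t'
reverse-middle-swapsEnds A M C d refl refl refl refl lM = record
  { prefix-before = trans (cong sum (take-++-length A _)) (sym (cong sum (take-++-length A _)))
  ; prefix-after  = begin
      prefixSum (suc (length A + d)) (A ++ reverse M ++ C)
        ≡⟨ cong (λ k → prefixSum k (A ++ reverse M ++ C)) (sym (+-suc (length A) d)) ⟩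
      prefixSum (length A + suc d) (A ++ reverse M ++ C)
        ≡⟨ prefixSum-through A (reverse M) C (suc d) (trans (length-reverse M) lM) ⟩
      sum A + sum (reverse M)
        ≡⟨ cong (sum A +_) (sum-↭ (↭-reverse M)) ⟩
      sum A + sum M
        ≡⟨ sym (prefixSum-through A M C (suc d) lM) ⟩
      prefixSum (length A + suc d) (A ++ M ++ C)
        ≡⟨ cong (λ k → prefixSum k (A ++ M ++ C)) (+-suc (length A) d) ⟩
      prefixSum (suc (length A + d)) (A ++ M ++ C) ∎
  ; first-block   = begin
      lenAt (A ++ reverse M ++ C) (length A)    ≡⟨ cong (λ z → sum (take 1 z)) (drop-++-length A _) ⟩
      lenAt (reverse M ++ C) 0                  ≡⟨ lenAt-reverse-first M C d lM ⟩
      lenAt (M ++ C) d                          ≡⟨ cong (λ z → sum (take 1 z)) (sym (drop-++-length+ A _ d)) ⟩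
      lenAt (A ++ M ++ C) (length A + d)        ∎
  ; last-block    = begin
      lenAt (A ++ reverse M ++ C) (length A + d) ≡⟨ cong (λ z → sum (take 1 z)) (drop-++-length+ A _ d) ⟩
      lenAt (reverse M ++ C) d                   ≡⟨ lenAt-reverse-last M C d lM ⟩
      lenAt (M ++ C) 0                           ≡⟨ cong (λ z → sum (take 1 z)) (sym (drop-++-length A _)) ⟩
      lenAt (A ++ M ++ C) (length A)             ∎
  ; same-length   = begin
      length (A ++ reverse M ++ C)          ≡⟨ length-++ A ⟩
      length A + length (reverse M ++ C)    ≡⟨ cong (length A +_) (length-++ (reverse M)) ⟩
      length A + (length (reverse M) + length C) ≡⟨ cong (λ k → length A + (k + length C)) (length-reverse M) ⟩
      length A + (length M + length C)      ≡⟨ cong (length A +_) (sym (length-++ M)) ⟩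
      length A + length (M ++ C)            ≡⟨ sym (length-++ A) ⟩
      length (A ++ M ++ C)                  ∎
  }
  where open ≡-Reasoning

revRange-swapsEnds : ∀ ls s' t' → s' ≤ t' → t' < length ls → SwapsEnds ls (revRange (suc s') (suc t') ls) s' t'
revRange-swapsEnds ls s' t' s≤t t< =
  reverse-middle-swapsEnds A M C d (sym ls-split) rev-split lA (sym s+d) lM
  where
  d = t' ∸ s'
  A = take s' ls
  M = take (suc d) (drop s' ls)
  C = drop (suc d) (drop s' ls)
  s+d : s' + d ≡ t'
  s+d = m+[n∸m]≡n s≤t
  ls-split : A ++ M ++ C ≡ ls
  ls-split = trans (cong (A ++_) (take++drop≡id (suc d) (drop s' ls))) (take++drop≡id s' ls)
  rev-split : revRange (suc s') (suc t') ls ≡ A ++ reverse M ++ C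
  rev-split = cong₂ (λ k z → A ++ reverse (take k (drop s' ls)) ++ z)
    (+-∸-assoc 1 s≤t)
    (sym (trans (drop-drop s' (suc d) ls) (cong (λ k → drop k ls) (trans (+-suc s' d) (cong suc s+d)))))
  lA : length A ≡ s'
  lA = trans (length-take s' ls) (m≤n⇒m⊓n≡m (≤-trans s≤t (<⇒≤ t<)))
  fitsM : suc d ≤ length (drop s' ls)
  fitsM = subst (suc d ≤_) (sym (length-drop s' ls))
    (m+n≤o⇒m≤o∸n (suc d) (subst (_≤ length ls) (sym (trans (cong suc (+-comm d s')) (cong suc s+d))) t<))
  lM : length M ≡ suc d
  lM = trans (length-take (suc d) (drop s' ls)) (m≤n⇒m⊓n≡m fitsM)

∸-exchange : ∀ S T a b → S ∸ a ∸ (T + b) ≡ S ∸ b ∸ (T + a)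
∸-exchange S T a b = begin
    S ∸ a ∸ (T + b)   ≡⟨ ∸-+-assoc S a (T + b) ⟩
    S ∸ (a + (T + b)) ≡⟨ cong (S ∸_) (solve 3 (λ a b T → a :+ (T :+ b) := b :+ (T :+ a)) refl a b T) ⟩
    S ∸ (b + (T + a)) ≡⟨ sym (∸-+-assoc S b (T + a)) ⟩
    S ∸ b ∸ (T + a)   ∎
  where open ≡-Reasoning

ρS-subseq : ∀ P → IsSubseq P → IsSubseq (ρS P) × subLen (ρS P) ≡ subLen P
ρS-subseq (subseq B zero t α β) (() , _)
ρS-subseq (subseq B (suc s') zero α β) (_ , () , _)
ρS-subseq P@(subseq (bd b ls) (suc s') (suc t') α β) (1≤s , s≤t , t≤n , α< , β< , 2≤L) =
  ( 1≤s , s≤t , subst (suc t' ≤_) (sym same-length) t≤n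
  , subst (β <_) (sym first-block) β< , subst (α <_) (sym last-block) α<
  , subst (2 ≤_) (sym sameLength) 2≤L )
  , sameLength
  where
  open SwapsEnds (revRange-swapsEnds ls s' t' (s≤s⁻¹ s≤t) t≤n)
  sameLength : subLen (ρS P) ≡ subLen P
  sameLength = trans (cong₂ (λ S T → S ∸ α ∸ (T + β)) prefix-after prefix-before)
                     (∸-exchange (prefixSum (suc t') ls) (prefixSum s' ls) α β)

lemma5p8 : (n w : ℕ) (S : BDSet) → ReflectivelyClosed n w S →
    (P : Subseq) → InT S P → ρS P ≢ P →
    (Trivial P × Trivial (ρS P)) ⊎ (¬ Trivial P × ¬ Trivial (ρS P))
lemma5p8 _ _ _ _ P (_ , isP , _) _ =
  flipEnds-sameTriviality {k = k (subLen P)} (subword-flipEnds P isP) ρP-ends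
  where
  k : ℕ → ℕ
  k L = L ∸ 1 + (t P ∸ s P)
  ρP : IsSubseq (ρS P) × subLen (ρS P) ≡ subLen P
  ρP = ρS-subseq P isP
  ρP-ends : FlipEnds (subword (ρS P)) (k (subLen P))
  ρP-ends = subst (λ L → FlipEnds (subword (ρS P)) (k L)) (proj₂ ρP) (subword-flipEnds (ρS P) (proj₁ ρP))
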